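{- Let $n>d>\ell\ge 1$ be integers, and let $r$ be the integer with $0<r\le \ell+1$ and $r\equiv d+1 \pmod{\ell+1}$. Then $$ e^{\ell+1}\left(\frac{d+1}{\ell+1}\right)^{\ell+1}\;\ge\;\binom{d+1}{\ell+1}\;\ge\; p_d^{(\ell)}\;\ge\;\left\lceil \frac{d+1}{\ell+1}\right\rceil^{r}\left\lfloor \frac{d+1}{\ell+1}\right\rfloor^{\ell+1-r}. $$
   Context: $Q_n$ is the $n$-dimensional hypercube, the graph on $\{0,1\}^n$ in which two vertices are adjacent iff they differ in exactly one coordinate. For $1\le i\le n-1$, a copy of $Q_i$ in $Q_n$ (a subcube) is the subgraph of $Q_n$ induced by all vertices that agree with a fixed $0/1$ assignment on a fixed set of $n-i$ coordinates (the other $i$ coordinates are free); $\mathcal{H}_n^i$ denotes the set of all such copies of $Q_i$ in $Q_n$ (so $|\mathcal{H}_n^i|=2^{n-i}\binom{n}{i}$). For $\ell<d$, a coloring of $\mathcal{H}_n^\ell$ is called $d,\ell$-polychromatic if every member of $\mathcal{H}_n^d$ contains, for each color used, a member of $\mathcal{H}_n^\ell$ of that color. $pc^{(\ell)}(n,d)$ is the largest number of colors in a $d,\ell$-polychromatic coloring of $\mathcal{H}_n^\ell$; it is non-increasing in $n$, and $p_d^{(\ell)}=\lim_{n\to\infty} pc^{(\ell)}(n,d)$. -}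

module Defs where

open import Data.Nat as ℕ using (ℕ; zero; suc; _≤_; _<_; _∸_)
open import Data.Nat.DivMod using (_/_)
open import Data.Nat using (_!)
open import Data.Nat.Combinatorics using (_C_)
open import Data.Nat.Properties using (_!≢0)
open import Data.Bool using (Bool)
open import Data.Empty using (⊥)
open import Data.Maybe using (Maybe; just; nothing)
open import Data.Fin using (Fin)
open import Data.Vec using (Vec; []; _∷_)
open import Data.Product using (Σ; ∃; _×_; _,_; proj₁)
open import Relation.Binary.PropositionalEquality using (_≡_)
open import Function.Definitions using (Surjective)
open import Data.Integer using (+_)
import Data.Rational as ℚ
open ℚ using (ℚ)

-- A subcube of Q_n is described by a word in {0,1,*}^n, encoded as a
-- vector of 'Maybe Bool': 'just b' = coordinate fixed to b,
-- 'nothing' = free coordinate.  Its dimension is the number of free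
-- coordinates.  (Distinct words give distinct induced subgraphs, so
-- this is a faithful encoding of the set of copies of Q_i in Q_n.)

Word : ℕ → Set
Word n = Vec (Maybe Bool) n

dim : ∀ {n} → Word n → ℕ
dim []             = 0
dim (nothing ∷ w)  = suc (dim w)
dim (just _ ∷ w)   = dim w

H : ℕ → ℕ → Set
H n i = Σ (Word n) (λ w → dim w ≡ i)

-- Containment of subcubes (of their vertex sets, equivalently of the
-- induced subgraphs): every coordinate fixed in the big cube is fixed
-- to the same value in the small cube.
data _⊑_ : ∀ {n} → Word n → Word n → Set where
  []⊑      : [] ⊑ []
  free⊑    : ∀ {n} {x : Maybe Bool} {v w : Word n} → v ⊑ w → (x ∷ v) ⊑ (nothing ∷ w)
  fixed⊑   : ∀ {n} {b : Bool} {v w : Word n} → v ⊑ w → (just b ∷ v) ⊑ (just b ∷ w)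

Polychromatic : (n d ℓ k : ℕ) → (H n ℓ → Fin k) → Set
Polychromatic n d ℓ k col =
  (D : H n d) (c : Fin k) →
  (∃ λ (L : H n ℓ) → col L ≡ c) →
  ∃ λ (L : H n ℓ) → (proj₁ L ⊑ proj₁ D) × (col L ≡ c)

HasPC : (n d ℓ k : ℕ) → Set
HasPC n d ℓ k =
  Σ (H n ℓ → Fin k) λ col →
    Surjective _≡_ _≡_ col × Polychromatic n d ℓ k col

pc≥ : (n d ℓ k : ℕ) → Set
pc≥ n d ℓ k = HasPC n d ℓ k

pc≤ : (n d ℓ B : ℕ) → Set
pc≤ n d ℓ B = ∀ k → B < k → HasPC n d ℓ k → ⊥

-- p_d^{(ℓ)} = lim_n pc^{(ℓ)}(n,d); for an integer-valued sequence,
-- lim ≥ L  iff  eventually ≥ L, and lim ≤ B iff eventually ≤ B.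
p≥ : (d ℓ L : ℕ) → Set
p≥ d ℓ L = ∃ λ N → ∀ n → N ≤ n → pc≥ n d ℓ L

p≤ : (d ℓ B : ℕ) → Set
p≤ d ℓ B = ∃ λ N → ∀ n → N ≤ n → pc≤ n d ℓ B

⌊_/_⌋ : (a b : ℕ) → .{{ℕ.NonZero b}} → ℕ
⌊ a / b ⌋ = a / b

⌈_/_⌉ : (a b : ℕ) → .{{ℕ.NonZero b}} → ℕ
⌈ a / b ⌉ = (a ℕ.+ (b ∸ 1)) / b

_^ℚ_ : ℚ → ℕ → ℚ
q ^ℚ zero  = ℚ.1ℚ
q ^ℚ suc k = q ℚ.* (q ^ℚ k)

fromℕ : ℕ → ℚ
fromℕ m = + m ℚ./ 1

inv! : ℕ → ℚ
inv! j = ℚ._/_ (+ 1) (j !) {{j !≢0}}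

eApprox : ℕ → ℚ
eApprox zero    = inv! 0
eApprox (suc N) = inv! (suc N) ℚ.+ eApprox N

-- LeExpTimes k x y  encodes the real inequality  x ≤ e^k · y
-- (for rationals x and y ≥ 0), using e = lim_N Σ_{j≤N} 1/j! (an
-- increasing sequence): x ≤ e^k·y  iff  for every rational ε > 0 there
-- is N with x ≤ (Σ_{j≤N} 1/j!)^k · y + ε.
LeExpTimes : ℕ → ℚ → ℚ → Set
LeExpTimes k x y =
  ∀ (ε : ℚ) → ℚ.0ℚ ℚ.< ε → ∃ λ N → x ℚ.≤ ((eApprox N ^ℚ k) ℚ.* y) ℚ.+ ε

-- Apply Ramsey's theorem for ordered sets to the coordinates
-- of Q_n.  An ℓ-subcube of the d-cube that is free on
-- a set Y of coordinates (and 0 elsewhere) is determined by the positions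
-- S ⊆ Y of its coordinates that are not 0 and by its pattern σ ∈ {1,*}^|S|.
-- Homogenising simultaneously over all patterns with ℓ stars and length at
-- most d yields a d-subcube in which the colour of an ℓ-subcube depends only
-- on its pattern; there are Σ_{t ≤ d} C(t,ℓ) = C(d+1,ℓ+1) patterns, so a
-- polychromatic colouring uses at most that many colours.
--
-- Write d+1 = q₀ + … + q_ℓ and colour an ℓ-subcube by the
-- numbers of ones in the ℓ+1 segments cut out by its stars, modulo
-- q₀, …, q_ℓ.  In any d-subcube, giving the i-th segment q_i of the free
-- coordinates (for i > 0 the first of them becomes the star opening it)
-- realises every residue, so all Π q_i colours appear; taking the q_i as balanced as
-- possible gives the product of ceilings and floors.
--
-- The first inequality is C(m,k) ≤ m^k/k! = (m/k)^k k^k/k! ≤ (m/k)^k e^k.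

module Submission where

module Thinnings where

  open import Data.Nat using (ℕ; zero; suc; _≤_; z≤n; s≤s)
  open import Data.Nat.Properties using (m≤n⇒m≤1+n)
  open import Data.Vec using (Vec; []; _∷_; replicate)
  open import Relation.Binary.PropositionalEquality using (_≡_; refl; cong)

  data Thinning : ℕ → ℕ → Set where
    done : Thinning 0 0
    skip : ∀ {m n} → Thinning m n → Thinning m (suc n)
    keep : ∀ {m n} → Thinning m n → Thinning (suc m) (suc n)

  infixr 9 _∘ᵗ_

  _∘ᵗ_ : ∀ {t m n} → Thinning m n → Thinning t m → Thinning t n
  done   ∘ᵗ done   = done
  skip Y ∘ᵗ S      = skip (Y ∘ᵗ S)
  keep Y ∘ᵗ skip S = skip (Y ∘ᵗ S)
  keep Y ∘ᵗ keep S = keep (Y ∘ᵗ S)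

  ∘ᵗ-assoc : ∀ {s t m n} (Y : Thinning m n) (Z : Thinning t m) (S : Thinning s t) →
             (Y ∘ᵗ Z) ∘ᵗ S ≡ Y ∘ᵗ (Z ∘ᵗ S)
  ∘ᵗ-assoc done     done     done     = refl
  ∘ᵗ-assoc (skip Y) Z        S        = cong skip (∘ᵗ-assoc Y Z S)
  ∘ᵗ-assoc (keep Y) (skip Z) S        = cong skip (∘ᵗ-assoc Y Z S)
  ∘ᵗ-assoc (keep Y) (keep Z) (skip S) = cong skip (∘ᵗ-assoc Y Z S)
  ∘ᵗ-assoc (keep Y) (keep Z) (keep S) = cong keep (∘ᵗ-assoc Y Z S)

  idᵗ : ∀ {n} → Thinning n n
  idᵗ {zero}  = done
  idᵗ {suc n} = keep idᵗ

  emptyᵗ : ∀ {n} → Thinning 0 n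
  emptyᵗ {zero}  = done
  emptyᵗ {suc n} = skip emptyᵗ

  emptyᵗ-unique : ∀ {n} (S : Thinning 0 n) → S ≡ emptyᵗ
  emptyᵗ-unique done     = refl
  emptyᵗ-unique (skip S) = cong skip (emptyᵗ-unique S)

  ≤⇒thinning : ∀ {m n} → m ≤ n → Thinning m n
  ≤⇒thinning {zero}              _       = emptyᵗ
  ≤⇒thinning {suc m} {suc n} (s≤s m≤n) = keep (≤⇒thinning m≤n)

  thinning⇒≤ : ∀ {m n} → Thinning m n → m ≤ n
  thinning⇒≤ done     = z≤n
  thinning⇒≤ (skip S) = m≤n⇒m≤1+n (thinning⇒≤ S)
  thinning⇒≤ (keep S) = s≤s (thinning⇒≤ S)

  module _ {A : Set} where

    restrict : ∀ {m n} → Thinning m n → Vec A n → Vec A m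
    restrict done     []       = []
    restrict (skip S) (x ∷ xs) = restrict S xs
    restrict (keep S) (x ∷ xs) = x ∷ restrict S xs

    restrict-∘ᵗ : ∀ {t m n} (Y : Thinning m n) (S : Thinning t m) (v : Vec A n) →
                  restrict (Y ∘ᵗ S) v ≡ restrict S (restrict Y v)
    restrict-∘ᵗ done     done     []      = refl
    restrict-∘ᵗ (skip Y) S        (x ∷ v) = restrict-∘ᵗ Y S v
    restrict-∘ᵗ (keep Y) (skip S) (x ∷ v) = restrict-∘ᵗ Y S v
    restrict-∘ᵗ (keep Y) (keep S) (x ∷ v) = cong (x ∷_) (restrict-∘ᵗ Y S v)

    restrict-replicate : ∀ {m n} (S : Thinning m n) (x : A) →
                         restrict S (replicate n x) ≡ replicate m x
    restrict-replicate done     x = refl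
    restrict-replicate (skip S) x = restrict-replicate S x
    restrict-replicate (keep S) x = cong (x ∷_) (restrict-replicate S x)

    lookupLeast : ∀ {t n} → Vec A n → Thinning (suc t) n → A
    lookupLeast (x ∷ xs) (keep _) = x
    lookupLeast (x ∷ xs) (skip S) = lookupLeast xs S

    lookupLeast-∘ᵗ : ∀ {t m n} (v : Vec A n) (W : Thinning m n) (S : Thinning (suc t) m) →
                     lookupLeast v (W ∘ᵗ S) ≡ lookupLeast (restrict W v) S
    lookupLeast-∘ᵗ (x ∷ v) (skip W) S        = lookupLeast-∘ᵗ v W S
    lookupLeast-∘ᵗ (x ∷ v) (keep W) (skip S) = lookupLeast-∘ᵗ v W S
    lookupLeast-∘ᵗ (x ∷ v) (keep W) (keep S) = refl

    lookupLeast-replicate : ∀ {t m} (x : A) (S : Thinning (suc t) m) →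
                            lookupLeast (replicate m x) S ≡ x
    lookupLeast-replicate x (skip S) = lookupLeast-replicate x S
    lookupLeast-replicate x (keep S) = refl

module Ramsey where

  open Thinnings
  open import Data.Nat using (ℕ; zero; suc; _+_; _*_; _<_; s≤s; _≤?_)
  open import Data.Nat.Properties
    using (+-suc; +-cancelˡ-<; +-monoˡ-<; ≰⇒>; ≤-reflexive; module ≤-Reasoning)
  open import Data.Fin using (Fin; zero; suc)
  open import Data.Fin.Properties using (_≟_)
  open import Data.Vec using (Vec; []; _∷_; replicate)
  import Data.Vec.Relation.Unary.All as Vecᴬ
  open import Data.List using (List; []; _∷_; length; lookup; allFin)
  open import Data.List.Properties using (length-tabulate)
  open import Data.List.Membership.Propositional using (_∈_)
  open import Data.List.Membership.Propositional.Properties using (∈-allFin)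
  open import Data.List.Relation.Unary.Any using (here; there)
  open import Data.Product using (Σ; ∃; _,_)
  open import Relation.Binary.Definitions using (DecidableEquality)
  open import Relation.Binary.PropositionalEquality
    using (_≡_; refl; sym; trans; cong; module ≡-Reasoning)
  open import Relation.Nullary using (yes; no)
  open import Data.Empty using (⊥-elim)

  module Pigeonhole {A : Set} (_≟ᴬ_ : DecidableEquality A) where

    count≡ count≢ : ∀ {q} → A → Vec A q → ℕ
    count≡ x [] = 0
    count≡ x (y ∷ v) with x ≟ᴬ y
    ... | yes _ = suc (count≡ x v)
    ... | no  _ = count≡ x v
    count≢ x [] = 0
    count≢ x (y ∷ v) with x ≟ᴬ y
    ... | yes _ = count≢ x v
    ... | no  _ = suc (count≢ x v)

    count≡+count≢ : ∀ {q} (x : A) (v : Vec A q) → count≡ x v + count≢ x v ≡ q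
    count≡+count≢ x [] = refl
    count≡+count≢ x (y ∷ v) with x ≟ᴬ y
    ... | yes _ = cong suc (count≡+count≢ x v)
    ... | no  _ = trans (+-suc (count≡ x v) (count≢ x v)) (cong suc (count≡+count≢ x v))

    positions≡ : ∀ {q} (x : A) (v : Vec A q) → Thinning (count≡ x v) q
    positions≡ x [] = done
    positions≡ x (y ∷ v) with x ≟ᴬ y
    ... | yes _ = keep (positions≡ x v)
    ... | no  _ = skip (positions≡ x v)

    positions≢ : ∀ {q} (x : A) (v : Vec A q) → Thinning (count≢ x v) q
    positions≢ x [] = done
    positions≢ x (y ∷ v) with x ≟ᴬ y
    ... | yes _ = skip (positions≢ x v)
    ... | no  _ = keep (positions≢ x v)

    restrict-positions≡ : ∀ {q} (x : A) (v : Vec A q) →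
                          restrict (positions≡ x v) v ≡ replicate (count≡ x v) x
    restrict-positions≡ x [] = refl
    restrict-positions≡ x (y ∷ v) with x ≟ᴬ y
    ... | yes refl = cong (x ∷_) (restrict-positions≡ x v)
    ... | no  _    = restrict-positions≡ x v

    restrict-positions≢ : ∀ {q} (x : A) (xs : List A) (v : Vec A q) →
                          Vecᴬ.All (_∈ x ∷ xs) v → Vecᴬ.All (_∈ xs) (restrict (positions≢ x v) v)
    restrict-positions≢ x xs [] Vecᴬ.[] = Vecᴬ.[]
    restrict-positions≢ x xs (y ∷ v) (y∈ Vecᴬ.∷ v∈) with x ≟ᴬ y | y∈
    ... | yes _ | _        = restrict-positions≢ x xs v v∈
    ... | no x≢y | here y≡x = ⊥-elim (x≢y (sym y≡x))
    ... | no _  | there y∈xs = y∈xs Vecᴬ.∷ restrict-positions≢ x xs v v∈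

    pigeonhole : ∀ (xs : List A) (m : ℕ) {q} (v : Vec A q) → Vecᴬ.All (_∈ xs) v →
                 length xs * m < q → Σ A λ x → Σ (Thinning m q) λ W → restrict W v ≡ replicate m x
    pigeonhole [] m [] Vecᴬ.[] ()
    pigeonhole (x ∷ xs) m {q} v v∈ q>|xs|m with m ≤? count≡ x v
    ... | yes m≤c = x , positions≡ x v ∘ᵗ ≤⇒thinning m≤c , (begin
        restrict (positions≡ x v ∘ᵗ ≤⇒thinning m≤c) v
          ≡⟨ restrict-∘ᵗ (positions≡ x v) (≤⇒thinning m≤c) v ⟩
        restrict (≤⇒thinning m≤c) (restrict (positions≡ x v) v)
          ≡⟨ cong (restrict (≤⇒thinning m≤c)) (restrict-positions≡ x v) ⟩
        restrict (≤⇒thinning m≤c) (replicate (count≡ x v) x)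
          ≡⟨ restrict-replicate (≤⇒thinning m≤c) x ⟩
        replicate m x ∎)
      where open ≡-Reasoning
    ... | no m≰c =
      let y , W , W-const = pigeonhole xs m (restrict (positions≢ x v) v)
                              (restrict-positions≢ x xs v v∈) fewer
      in y , positions≢ x v ∘ᵗ W , trans (restrict-∘ᵗ (positions≢ x v) W v) W-const
      where
      open ≤-Reasoning
      fewer : length xs * m < count≢ x v
      fewer = +-cancelˡ-< (count≡ x v) (length xs * m) (count≢ x v) (begin-strict
        count≡ x v + length xs * m <⟨ +-monoˡ-< (length xs * m) (≰⇒> m≰c) ⟩
        m + length xs * m          <⟨ q>|xs|m ⟩
        q                          ≡⟨ sym (count≡+count≢ x v) ⟩
        count≡ x v + count≢ x v    ∎)

  Monochromatic : ∀ {C : Set} {t m N} → (Thinning t N → C) → Thinning m N → C → Set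
  Monochromatic {t = t} {m} f Y κ = (S : Thinning t m) → f (Y ∘ᵗ S) ≡ κ

  module _ {C : Set} {t M N : ℕ} (f : Thinning t N → C) (Y₁ : Thinning M N) where

    Monochromatic-∘ᵗˡ : ∀ {m} (Y₂ : Thinning m M) {κ} →
                        Monochromatic (λ S → f (Y₁ ∘ᵗ S)) Y₂ κ → Monochromatic f (Y₁ ∘ᵗ Y₂) κ
    Monochromatic-∘ᵗˡ Y₂ mono S = trans (cong f (∘ᵗ-assoc Y₁ Y₂ S)) (mono S)

    Monochromatic-∘ᵗʳ : ∀ {m} (Y₂ : Thinning m M) {κ} →
                        Monochromatic f Y₁ κ → Monochromatic f (Y₁ ∘ᵗ Y₂) κ
    Monochromatic-∘ᵗʳ Y₂ mono S = trans (cong f (∘ᵗ-assoc Y₁ Y₂ S)) (mono (Y₂ ∘ᵗ S))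

  EndHomogeneous : ∀ {C : Set} {t m N} → (Thinning (suc t) N → C) → Thinning m N → Vec C m → Set
  EndHomogeneous {t = t} {m} f Z κ = (S : Thinning (suc t) m) → f (Z ∘ᵗ S) ≡ lookupLeast κ S

  module _ (c : ℕ) where

    private
      Colour = Fin (suc c)

    mutual
      ramseyBound : ℕ → ℕ → ℕ
      ramseyBound zero    m = m
      ramseyBound (suc t) m = endHomogeneousBound t (suc (suc c * m))

      endHomogeneousBound : ℕ → ℕ → ℕ
      endHomogeneousBound t zero    = 0
      endHomogeneousBound t (suc q) = suc (ramseyBound t (endHomogeneousBound t q))

    everyColour : ∀ {q} (κ : Vec Colour q) → Vecᴬ.All (_∈ allFin (suc c)) κ
    everyColour []      = Vecᴬ.[]
    everyColour (x ∷ κ) = ∈-allFin x Vecᴬ.∷ everyColour κ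

    mutual
      -- Pigeonhole on the colours attached to the points of an end-homogeneous set.
      ramsey : ∀ t m (f : Thinning t (ramseyBound t m) → Colour) →
               Σ (Thinning m (ramseyBound t m)) λ Y → ∃ (Monochromatic f Y)
      ramsey zero m f = idᵗ , f (idᵗ ∘ᵗ emptyᵗ) , λ S → cong (λ S → f (idᵗ ∘ᵗ S)) (emptyᵗ-unique S)
      ramsey (suc t) m f =
        let Z , κ , Z-end = endHomogeneous t (suc (suc c * m)) f
            x , W , W-const = pigeonhole (allFin (suc c)) m κ (everyColour κ) enough
        in Z ∘ᵗ W , x , λ S → begin
             f ((Z ∘ᵗ W) ∘ᵗ S)           ≡⟨ cong f (∘ᵗ-assoc Z W S) ⟩
             f (Z ∘ᵗ W ∘ᵗ S)             ≡⟨ Z-end (W ∘ᵗ S) ⟩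
             lookupLeast κ (W ∘ᵗ S)       ≡⟨ lookupLeast-∘ᵗ κ W S ⟩
             lookupLeast (restrict W κ) S ≡⟨ cong (λ v → lookupLeast v S) W-const ⟩
             lookupLeast (replicate m x) S ≡⟨ lookupLeast-replicate x S ⟩
             x                            ∎
        where
        open ≡-Reasoning
        open Pigeonhole _≟_
        enough : length (allFin (suc c)) * m < suc (suc c * m)
        enough = s≤s (≤-reflexive (cong (_* m) (length-tabulate {n = suc c} (λ i → i))))

      -- The least point is kept; the (t+1)-subsets through it are coloured by
      -- Ramsey for t-subsets of the remaining points, and we recurse on the
      -- monochromatic set obtained.
      endHomogeneous : ∀ t q (f : Thinning (suc t) (endHomogeneousBound t q) → Colour) →
                       Σ (Thinning q (endHomogeneousBound t q)) λ Z →
                       Σ (Vec Colour q) (EndHomogeneous f Z)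
      endHomogeneous t zero f = done , [] , λ ()
      endHomogeneous t (suc q) f =
        let Y , x , Y-mono = ramsey t (endHomogeneousBound t q) (λ S → f (keep S))
            Z , κ , Z-end = endHomogeneous t q (λ S → f (skip (Y ∘ᵗ S)))
        in keep (Y ∘ᵗ Z) , x ∷ κ , λ where
             (keep S) → Monochromatic-∘ᵗʳ (λ S → f (keep S)) Y Z Y-mono S
             (skip S) → trans (cong (λ S → f (skip S)) (∘ᵗ-assoc Y Z S)) (Z-end S)

    module _ {A : Set} (size : A → ℕ) where

      simultaneousRamseyBound : List A → ℕ → ℕ
      simultaneousRamseyBound []       m = m
      simultaneousRamseyBound (a ∷ as) m = ramseyBound (size a) (simultaneousRamseyBound as m)

      simultaneousRamsey : ∀ (as : List A) m →
                           (f : (a : A) → Thinning (size a) (simultaneousRamseyBound as m) → Colour) →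
                           Σ (Thinning m (simultaneousRamseyBound as m)) λ Y →
                           (i : Fin (length as)) → ∃ (Monochromatic (f (lookup as i)) Y)
      simultaneousRamsey []       m f = idᵗ , λ ()
      simultaneousRamsey (a ∷ as) m f =
        let Y₁ , x , Y₁-mono = ramsey (size a) (simultaneousRamseyBound as m) (f a)
            Y₂ , Y₂-mono = simultaneousRamsey as m (λ b S → f b (Y₁ ∘ᵗ S))
        in Y₁ ∘ᵗ Y₂ , λ where
             zero    → x , Monochromatic-∘ᵗʳ (f a) Y₁ Y₂ Y₁-mono
             (suc i) → let κ , mono = Y₂-mono i in κ , Monochromatic-∘ᵗˡ (f (lookup as i)) Y₁ Y₂ mono

module UpperBound where

  open Thinnings
  open Ramsey
  open import Defs
  open import Data.Nat using (ℕ; zero; suc; _+_; _≤_; _<_; z≤n; s≤s; s≤s⁻¹)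
  open import Data.Nat.Properties using (≡-irrelevant; +-comm; <-irrefl; ≤-trans; ≤-reflexive; _≟_)
  open import Data.Nat.Combinatorics using (_C_; nCk+nC[k+1]≡[n+1]C[k+1])
  open import Data.Bool using (Bool; true; false)
  open import Data.Maybe using (Maybe; just; nothing)
  open import Data.Fin using (Fin; zero; suc; inject≤)
  open import Data.Fin.Properties using (injective⇒≤)
  open import Data.Vec using (Vec; []; _∷_)
  open import Data.List using (List; []; _∷_; _++_; map; length)
  open import Data.List.Properties using (length-++; length-map)
  open import Data.List.Relation.Unary.Any using (here; there; index)
  open import Data.List.Relation.Unary.Any.Properties using (lookup-index)
  open import Data.List.Membership.Propositional using (_∈_)
  open import Data.List.Membership.Propositional.Properties using (∈-++⁺ˡ; ∈-++⁺ʳ; ∈-map⁺)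
  open import Data.Product using (Σ; ∃; _×_; _,_; proj₁; proj₂)
  open import Data.Empty using (⊥-elim)
  open import Function using (_∘_)
  open import Relation.Nullary using (yes; no)
  open import Relation.Binary.PropositionalEquality
    using (_≡_; refl; sym; trans; cong; cong₂; subst; module ≡-Reasoning)

  cubeOn : ∀ {d n} → Thinning d n → Word n
  cubeOn done     = []
  cubeOn (skip Y) = just false ∷ cubeOn Y
  cubeOn (keep Y) = nothing ∷ cubeOn Y

  dim-cubeOn : ∀ {d n} (Y : Thinning d n) → dim (cubeOn Y) ≡ d
  dim-cubeOn done     = refl
  dim-cubeOn (skip Y) = dim-cubeOn Y
  dim-cubeOn (keep Y) = cong suc (dim-cubeOn Y)

  -- A pattern σ ∈ {1,*}^t, with true for a free coordinate *; place σ S puts it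
  -- on the positions S and 0 everywhere else.
  Pattern : Set
  Pattern = Σ ℕ (Vec Bool)

  letter : Bool → Maybe Bool
  letter true  = nothing
  letter false = just true

  place : ∀ {t n} → Vec Bool t → Thinning t n → Word n
  place σ       done     = []
  place σ       (skip S) = just false ∷ place σ S
  place (b ∷ σ) (keep S) = letter b ∷ place σ S

  stars : ∀ {t} → Vec Bool t → ℕ
  stars []          = 0
  stars (true ∷ σ)  = suc (stars σ)
  stars (false ∷ σ) = stars σ

  dim-place : ∀ {t n} (σ : Vec Bool t) (S : Thinning t n) → dim (place σ S) ≡ stars σ
  dim-place []          done     = refl
  dim-place σ           (skip S) = dim-place σ S
  dim-place (true ∷ σ)  (keep S) = cong suc (dim-place σ S)
  dim-place (false ∷ σ) (keep S) = dim-place σ S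

  record Decomposition {d n} (Y : Thinning d n) (L : Word n) : Set where
    constructor decomposition
    field
      {arity}  : ℕ
      letters  : Vec Bool arity
      support  : Thinning arity d
      L≡place  : L ≡ place letters (Y ∘ᵗ support)

  decompose : ∀ {d n} (Y : Thinning d n) (L : Word n) → L ⊑ cubeOn Y → Decomposition Y L
  decompose done [] []⊑ = decomposition [] done refl
  decompose (skip Y) (just false ∷ L) (fixed⊑ L⊑) with decompose Y L L⊑
  ... | decomposition σ S e = decomposition σ S (cong (just false ∷_) e)
  decompose (keep Y) (x ∷ L) (free⊑ L⊑) with x | decompose Y L L⊑
  ... | just false | decomposition σ S e = decomposition σ (skip S) (cong (just false ∷_) e)
  ... | just true  | decomposition σ S e = decomposition (false ∷ σ) (keep S) (cong (just true ∷_) e)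
  ... | nothing    | decomposition σ S e = decomposition (true ∷ σ) (keep S) (cong (nothing ∷_) e)

  _∷ᵖ_ : Bool → Pattern → Pattern
  b ∷ᵖ (t , σ) = suc t , b ∷ σ

  patterns : ℕ → ℕ → List Pattern
  patterns zero    zero    = (0 , []) ∷ []
  patterns zero    (suc ℓ) = []
  patterns (suc d) zero    = (0 , []) ∷ map (false ∷ᵖ_) (patterns d zero)
  patterns (suc d) (suc ℓ) = map (false ∷ᵖ_) (patterns d (suc ℓ)) ++ map (true ∷ᵖ_) (patterns d ℓ)

  length-patterns : ∀ d ℓ → length (patterns d ℓ) ≡ suc d C suc ℓ
  length-patterns zero zero    = refl
  length-patterns zero (suc ℓ) = refl
  length-patterns (suc d) zero = trans
    (cong suc (trans (length-map (false ∷ᵖ_) (patterns d zero)) (length-patterns d zero)))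
    (nCk+nC[k+1]≡[n+1]C[k+1] (suc d) 0)
  length-patterns (suc d) (suc ℓ) = begin
    length (map (false ∷ᵖ_) (patterns d (suc ℓ)) ++ map (true ∷ᵖ_) (patterns d ℓ))
      ≡⟨ length-++ (map (false ∷ᵖ_) (patterns d (suc ℓ))) ⟩
    length (map (false ∷ᵖ_) (patterns d (suc ℓ))) + length (map (true ∷ᵖ_) (patterns d ℓ))
      ≡⟨ cong₂ _+_ (trans (length-map _ (patterns d (suc ℓ))) (length-patterns d (suc ℓ)))
                   (trans (length-map _ (patterns d ℓ)) (length-patterns d ℓ)) ⟩
    suc d C suc (suc ℓ) + suc d C suc ℓ
      ≡⟨ +-comm (suc d C suc (suc ℓ)) _ ⟩
    suc d C suc ℓ + suc d C suc (suc ℓ)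
      ≡⟨ nCk+nC[k+1]≡[n+1]C[k+1] (suc d) (suc ℓ) ⟩
    suc (suc d) C suc (suc ℓ) ∎
    where open ≡-Reasoning

  ∈-patterns : ∀ d ℓ {t} (σ : Vec Bool t) → t ≤ d → stars σ ≡ ℓ → (t , σ) ∈ patterns d ℓ
  ∈-patterns zero    zero    []          z≤n      refl = here refl
  ∈-patterns (suc d) zero    []          _        refl = here refl
  ∈-patterns (suc d) zero    (false ∷ σ) (s≤s t≤d) eq  =
    there (∈-map⁺ (false ∷ᵖ_) (∈-patterns d zero σ t≤d eq))
  ∈-patterns (suc d) (suc ℓ) (false ∷ σ) (s≤s t≤d) eq  =
    ∈-++⁺ˡ (∈-map⁺ (false ∷ᵖ_) (∈-patterns d (suc ℓ) σ t≤d eq))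
  ∈-patterns (suc d) (suc ℓ) (true ∷ σ)  (s≤s t≤d) refl =
    ∈-++⁺ʳ (map (false ∷ᵖ_) (patterns d (suc ℓ))) (∈-map⁺ (true ∷ᵖ_) (∈-patterns d ℓ σ t≤d refl))

  H-≡ : ∀ {n ℓ} {w₁ w₂ : Word n} (p : dim w₁ ≡ ℓ) (q : dim w₂ ≡ ℓ) → w₁ ≡ w₂ →
        _≡_ {A = H n ℓ} (w₁ , p) (w₂ , q)
  H-≡ p q refl = cong (_ ,_) (≡-irrelevant p q)

  module _ {d ℓ n : ℕ} {C : Set} (χ : H n ℓ → C) (default : C) where

    -- Patterns with the wrong number of stars describe no ℓ-subcube; they
    -- get an arbitrary colour.
    patternColouring : Thinning d n → (a : Pattern) → Thinning (proj₁ a) d → C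
    patternColouring Y (t , σ) S with stars σ ≟ ℓ
    ... | yes σ-stars = χ (place σ (Y ∘ᵗ S) , trans (dim-place σ (Y ∘ᵗ S)) σ-stars)
    ... | no  _       = default

    patternColouring-place : ∀ Y {t} (σ : Vec Bool t) (S : Thinning t d) (L : H n ℓ) →
                             stars σ ≡ ℓ → proj₁ L ≡ place σ (Y ∘ᵗ S) →
                             patternColouring Y (t , σ) S ≡ χ L
    patternColouring-place Y σ S L σ-stars L≡ with stars σ ≟ ℓ
    ... | yes _ = cong χ (H-≡ _ _ (sym L≡))
    ... | no  σ-stars′ = ⊥-elim (σ-stars′ σ-stars)

  module _ (d ℓ c : ℕ) where

    patternBound : ℕ
    patternBound = simultaneousRamseyBound c proj₁ (patterns d ℓ) d

    fewColoursInSubcube : ∀ {n} → patternBound ≤ n → (χ : H n ℓ → Fin (suc c)) →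
      Σ (H n d) λ D → Σ (Fin (length (patterns d ℓ)) → Fin (suc c)) λ κ →
      (L : H n ℓ) → proj₁ L ⊑ proj₁ D → ∃ λ i → χ L ≡ κ i
    fewColoursInSubcube {n} N≤n χ =
      (cubeOn (E ∘ᵗ Y) , dim-cubeOn (E ∘ᵗ Y)) , proj₁ ∘ mono , colourOf
      where
      E = ≤⇒thinning N≤n
      G = patternColouring χ zero E
      homogeneous = simultaneousRamsey c proj₁ (patterns d ℓ) d G
      Y = proj₁ homogeneous
      mono = proj₂ homogeneous

      colourOf : (L : H n ℓ) → proj₁ L ⊑ cubeOn (E ∘ᵗ Y) → ∃ λ i → χ L ≡ proj₁ (mono i)
      colourOf L L⊑ with decompose (E ∘ᵗ Y) (proj₁ L) L⊑
      ... | decomposition σ S L≡ = index σ∈ , (begin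
        χ L                       ≡⟨ sym (patternColouring-place χ zero E σ (Y ∘ᵗ S) L σ-stars L≡′) ⟩
        G (_ , σ) (Y ∘ᵗ S)        ≡⟨ mono-σ S ⟩
        proj₁ (mono (index σ∈))   ∎)
        where
        open ≡-Reasoning
        σ-stars : stars σ ≡ ℓ
        σ-stars = trans (sym (dim-place σ ((E ∘ᵗ Y) ∘ᵗ S))) (trans (cong dim (sym L≡)) (proj₂ L))
        L≡′ : proj₁ L ≡ place σ (E ∘ᵗ Y ∘ᵗ S)
        L≡′ = trans L≡ (cong (place σ) (∘ᵗ-assoc E Y S))
        σ∈ = ∈-patterns d ℓ σ (thinning⇒≤ S) σ-stars
        mono-σ : Monochromatic (G (_ , σ)) Y (proj₁ (mono (index σ∈)))
        mono-σ = subst (λ a → Monochromatic (G a) Y (proj₁ (mono (index σ∈))))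
                       (sym (lookup-index σ∈)) (proj₂ (mono (index σ∈)))

  clamp : ∀ {B k} → Fin k → Fin (suc B)
  clamp {zero}  _       = zero
  clamp {suc B} zero    = zero
  clamp {suc B} (suc x) = suc (clamp {B} x)

  clamp-inject≤ : ∀ {B k} (y : Fin (suc B)) .(B<k : B < k) → clamp {B} (inject≤ y B<k) ≡ y
  clamp-inject≤ {zero}  {suc k} zero    _   = refl
  clamp-inject≤ {suc B} {suc k} zero    _   = refl
  clamp-inject≤ {suc B} {suc k} (suc y) B<k = cong suc (clamp-inject≤ y (s≤s⁻¹ B<k))

  module _ (d ℓ : ℕ) where

    private
      B = suc d C suc ℓ

    -- The Ramsey bound may not depend on the number k > B of colours, so the
    -- colours are clamped to B + 1 classes first; polychromaticity still puts
    -- all B + 1 classes into the subcube D, which only has B patterns.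
    pc≤-binomial : ∀ {n} → patternBound d ℓ B ≤ n → pc≤ n d ℓ B
    pc≤-binomial {n} N≤n k B<k (col , col-onto , col-poly) =
      <-irrefl refl (≤-trans (injective⇒≤ indexOf-injective) (≤-reflexive (length-patterns d ℓ)))
      where
      subcube = fewColoursInSubcube d ℓ B N≤n (clamp ∘ col)
      D = proj₁ subcube
      κ = proj₁ (proj₂ subcube)
      colour≡κ = proj₂ (proj₂ subcube)

      witness : (y : Fin (suc B)) → ∃ λ (L : H n ℓ) → (proj₁ L ⊑ proj₁ D) × (col L ≡ inject≤ y B<k)
      witness y = col-poly D (inject≤ y B<k) (proj₁ (col-onto (inject≤ y B<k)) , proj₂ (col-onto _) refl)

      indexOf : Fin (suc B) → Fin (length (patterns d ℓ))
      indexOf y = let L , L⊑ , _ = witness y in proj₁ (colour≡κ L L⊑)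

      κ-indexOf : ∀ y → κ (indexOf y) ≡ y
      κ-indexOf y = let L , L⊑ , colL = witness y in begin
        κ (proj₁ (colour≡κ L L⊑)) ≡⟨ sym (proj₂ (colour≡κ L L⊑)) ⟩
        clamp (col L)             ≡⟨ cong clamp colL ⟩
        clamp (inject≤ y B<k)     ≡⟨ clamp-inject≤ y B<k ⟩
        y                         ∎
        where open ≡-Reasoning

      indexOf-injective : ∀ {y₁ y₂} → indexOf y₁ ≡ indexOf y₂ → y₁ ≡ y₂
      indexOf-injective {y₁} {y₂} eq = trans (sym (κ-indexOf y₁)) (trans (cong κ eq) (κ-indexOf y₂))

    p≤-binomial : p≤ d ℓ B
    p≤-binomial = patternBound d ℓ B , λ n N≤n → pc≤-binomial N≤n

module SegmentColouring where

  open Thinnings using (≤⇒thinning)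
  open UpperBound using (cubeOn; dim-cubeOn)
  open import Defs
  open import Data.Nat using (ℕ; zero; suc; _+_; _*_; _≤_; z≤n; s≤s; s≤s⁻¹)
  open import Data.Nat.Properties using (+-identityʳ; +-suc; suc-injective)
  open import Data.Nat.DivMod using (_%_; _mod_; %-distribˡ-+; m%n%n≡m%n; [m+kn]%n≡m%n; m<n⇒m%n≡m; m%n<n)
  open import Data.Nat.Solver using (module +-*-Solver)
  open import Data.Bool using (true; false)
  open import Data.Maybe using (just; nothing)
  open import Data.Fin using (Fin; zero; combine; toℕ)
  open import Data.Fin.Properties using (combine-surjective; toℕ-fromℕ<; toℕ-injective; toℕ<n)
  open import Data.Vec using ([]; _∷_)
  open import Data.List using (List; []; _∷_; length)
  open import Data.Product using (Σ; ∃; _×_; _,_; proj₁)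
  open import Relation.Binary.PropositionalEquality
    using (_≡_; refl; sym; trans; cong; cong₂; module ≡-Reasoning)

  sumSuc : List ℕ → ℕ
  sumSuc []       = 0
  sumSuc (p ∷ ps) = suc p + sumSuc ps

  productSuc : List ℕ → ℕ
  productSuc []       = 1
  productSuc (p ∷ ps) = suc p * productSuc ps

  fin₀ : ∀ ps → Fin (productSuc ps)
  fin₀ []       = zero
  fin₀ (p ∷ ps) = combine {suc p} zero (fin₀ ps)

  -- Segment i is counted modulo suc p for i = 0 and modulo the successors of
  -- the entries of ps after that; a counts the ones of the current segment
  -- seen so far.  Words with the wrong number of stars get junk colours.
  segmentColour : ∀ {n} (p : ℕ) (ps : List ℕ) → ℕ → Word n → Fin (suc p * productSuc ps)
  segmentColour p ps        a []               = combine (a mod suc p) (fin₀ ps)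
  segmentColour p ps        a (just true ∷ w)  = segmentColour p ps (suc a) w
  segmentColour p ps        a (just false ∷ w) = segmentColour p ps a w
  segmentColour p []        a (nothing ∷ w)    = segmentColour p [] a w
  segmentColour p (p′ ∷ ps) a (nothing ∷ w)    = combine (a mod suc p) (segmentColour p′ ps 0 w)

  onesBefore : ∀ {n} → ℕ → Word n → ℕ
  onesBefore β       []               = 0
  onesBefore β       (just true ∷ w)  = suc (onesBefore β w)
  onesBefore β       (just false ∷ w) = onesBefore β w
  onesBefore zero    (nothing ∷ w)    = 0
  onesBefore (suc β) (nothing ∷ w)    = onesBefore β w

  mod-shift : ∀ p x (i : Fin (suc p)) → ∃ λ j → j ≤ p × (j + x) mod suc p ≡ i
  mod-shift p x i = j , s≤s⁻¹ (m%n<n (toℕ i + p * x) (suc p)) , toℕ-injective (trans (toℕ-fromℕ< _) j+x≡i)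
    where
    open ≡-Reasoning
    open +-*-Solver
    j = (toℕ i + p * x) % suc p
    j+x≡i : (j + x) % suc p ≡ toℕ i
    j+x≡i = begin
      ((toℕ i + p * x) % suc p + x) % suc p
        ≡⟨ %-distribˡ-+ ((toℕ i + p * x) % suc p) x (suc p) ⟩
      ((toℕ i + p * x) % suc p % suc p + x % suc p) % suc p
        ≡⟨ cong (λ y → (y + x % suc p) % suc p) (m%n%n≡m%n (toℕ i + p * x) (suc p)) ⟩
      ((toℕ i + p * x) % suc p + x % suc p) % suc p
        ≡⟨ sym (%-distribˡ-+ (toℕ i + p * x) x (suc p)) ⟩
      (toℕ i + p * x + x) % suc p
        ≡⟨ cong (_% suc p) (solve 3 (λ i p x → i :+ p :* x :+ x := i :+ x :* (con 1 :+ p)) refl (toℕ i) p x) ⟩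
      (toℕ i + x * suc p) % suc p
        ≡⟨ [m+kn]%n≡m%n (toℕ i) x (suc p) ⟩
      toℕ i % suc p
        ≡⟨ m<n⇒m%n≡m (toℕ<n i) ⟩
      toℕ i ∎

  Realisable : ∀ {n} (p : ℕ) (ps : List ℕ) (β : ℕ) (D : Word n) (a j : ℕ) (c′ : Fin (productSuc ps)) → Set
  Realisable p ps β D a j c′ = Σ (Word _) λ L → (L ⊑ D) × (dim L ≡ length ps) ×
    (segmentColour p ps a L ≡ combine ((a + j + onesBefore β D) mod suc p) c′)

  -- The first β free coordinates of D stay in the current segment: the first
  -- j of them become ones, the others zeros.  The next free coordinate becomes
  -- a star, and the residue of the next segment is adjusted by mod-shift.
  realise : ∀ {n} p ps β (D : Word n) → dim D ≡ β + sumSuc ps →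
            ∀ a j → j ≤ β → (c′ : Fin (productSuc ps)) → Realisable p ps β D a j c′
  realise p [] zero [] _ a zero z≤n zero =
    [] , []⊑ , refl , cong (λ y → combine (y mod suc p) zero) (sym (trans (+-identityʳ (a + 0)) (+-identityʳ a)))
  realise p (_ ∷ _) zero [] ()
  realise p ps (suc β) [] ()
  realise p [] zero (nothing ∷ D) ()
  realise p ps β (just true ∷ D) dimD a j j≤β c′ with realise p ps β D dimD (suc a) j j≤β c′
  ... | L , L⊑ , dimL , colL = just true ∷ L , fixed⊑ L⊑ , dimL ,
    trans colL (cong (λ y → combine (y mod suc p) c′) (sym (+-suc (a + j) (onesBefore β D))))
  realise p ps β (just false ∷ D) dimD a j j≤β c′ with realise p ps β D dimD a j j≤β c′
  ... | L , L⊑ , dimL , colL = just false ∷ L , fixed⊑ L⊑ , dimL , colL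
  realise p ps (suc β) (nothing ∷ D) dimD a zero _ c′ with realise p ps β D (suc-injective dimD) a zero z≤n c′
  ... | L , L⊑ , dimL , colL = just false ∷ L , free⊑ L⊑ , dimL , colL
  realise p ps (suc β) (nothing ∷ D) dimD a (suc j) (s≤s j≤β) c′
    with realise p ps β D (suc-injective dimD) (suc a) j j≤β c′
  ... | L , L⊑ , dimL , colL = just true ∷ L , free⊑ L⊑ , dimL ,
    trans colL (cong (λ y → combine ((y + onesBefore β D) mod suc p) c′) (sym (+-suc a j)))
  realise p (p′ ∷ ps) zero (nothing ∷ D) dimD a zero z≤n c′
    with combine-surjective {suc p′} {productSuc ps} c′
  ... | i , c″ , c′≡ with mod-shift p′ (onesBefore p′ D) i
  ... | j , j≤p′ , j≡ with realise p′ ps p′ D (suc-injective dimD) 0 j j≤p′ c″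
  ... | L , L⊑ , dimL , colL = nothing ∷ L , free⊑ L⊑ , cong suc dimL ,
    cong₂ combine (cong (_mod suc p) (sym (trans (+-identityʳ (a + 0)) (+-identityʳ a))))
                  (trans colL (trans (cong (λ i → combine i c″) j≡) c′≡))

  pc≥-product : ∀ {n d ℓ} p ps → length ps ≡ ℓ → p + sumSuc ps ≡ d → d ≤ n →
                pc≥ n d ℓ (suc p * productSuc ps)
  pc≥-product {n} {d} {ℓ} p ps ps-length ps-sum d≤n = colour , colour-onto , colour-poly
    where
    colour : H n ℓ → Fin (suc p * productSuc ps)
    colour L = segmentColour p ps 0 (proj₁ L)

    realised : (D : H n d) (c : Fin (suc p * productSuc ps)) →
               ∃ λ (L : H n ℓ) → (proj₁ L ⊑ proj₁ D) × (colour L ≡ c)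
    realised (D , dimD) c with combine-surjective {suc p} {productSuc ps} c
    ... | i , c′ , c≡ with mod-shift p (onesBefore p D) i
    ... | j , j≤p , j≡ with realise p ps p D (trans dimD (sym ps-sum)) 0 j j≤p c′
    ... | L , L⊑ , dimL , colL = (L , trans dimL ps-length) , L⊑ ,
      trans colL (trans (cong (λ i → combine i c′) j≡) c≡)

    colour-poly : Polychromatic n d ℓ (suc p * productSuc ps) colour
    colour-poly D c _ = realised D c

    colour-onto : ∀ c → ∃ λ L → ∀ {L′} → L′ ≡ L → colour L′ ≡ c
    colour-onto c with realised (cubeOn (≤⇒thinning d≤n) , dim-cubeOn (≤⇒thinning d≤n)) c
    ... | L , _ , colL = L , λ { refl → colL }

module LowerBound where

  open SegmentColouring
  open import Defs
  open import Data.Nat using (ℕ; zero; suc; _+_; _*_; _∸_; _^_; _≤_; _<_; s≤s; NonZero)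
  open import Data.Nat.Properties
    using ( *-comm; +-assoc; +-identityʳ; ≤-refl; *-assoc; m+[n∸m]≡n; n∸n≡0; <⇒≤
          ; ≤-antisym; ≮⇒≥; <-irrefl; m≤m+n; _<?_)
  open import Data.Nat.DivMod
    using ( _%_; _/_; m≡m%n+[m/n]*n; m<n⇒m%n≡m; n%n≡0; m*n%n≡0; m<n⇒m/n≡0; m*n/n≡m
          ; +-distrib-/; /-monoˡ-≤; m≥n⇒m/n>0)
  open import Data.Nat.Solver using (module +-*-Solver)
  open import Data.List using ([]; _∷_; _++_; length; replicate)
  open import Data.List.Properties using (length-++; length-replicate)
  open import Data.Product using (_,_)
  open import Data.Empty using (⊥-elim)
  open import Relation.Nullary using (yes; no)
  open import Relation.Binary.PropositionalEquality
    using (_≡_; refl; sym; trans; cong; cong₂; subst; subst₂; module ≡-Reasoning)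

  open +-*-Solver

  sumSuc-++ : ∀ xs ys → sumSuc (xs ++ ys) ≡ sumSuc xs + sumSuc ys
  sumSuc-++ []       ys = refl
  sumSuc-++ (x ∷ xs) ys = trans (cong (suc x +_) (sumSuc-++ xs ys)) (sym (+-assoc (suc x) (sumSuc xs) (sumSuc ys)))

  productSuc-++ : ∀ xs ys → productSuc (xs ++ ys) ≡ productSuc xs * productSuc ys
  productSuc-++ []       ys = sym (+-identityʳ (productSuc ys))
  productSuc-++ (x ∷ xs) ys = trans (cong (suc x *_) (productSuc-++ xs ys)) (sym (*-assoc (suc x) (productSuc xs) (productSuc ys)))

  sumSuc-replicate : ∀ m a → sumSuc (replicate m a) ≡ m * suc a
  sumSuc-replicate zero    a = refl
  sumSuc-replicate (suc m) a = cong (suc a +_) (sumSuc-replicate m a)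

  productSuc-replicate : ∀ m a → productSuc (replicate m a) ≡ suc a ^ m
  productSuc-replicate zero    a = refl
  productSuc-replicate (suc m) a = cong (suc a *_) (productSuc-replicate m a)

  p≥-two-sizes : ∀ d ℓ s a b → s ≤ ℓ → suc s * suc a + (ℓ ∸ s) * suc b ≡ suc d →
                 p≥ d ℓ (suc a ^ suc s * suc b ^ (ℓ ∸ s))
  p≥-two-sizes d ℓ s a b s≤ℓ parts-sum = d , λ n d≤n →
    subst (pc≥ n d ℓ) product≡ (pc≥-product a ps length≡ sum≡ d≤n)
    where
    open ≡-Reasoning
    ps = replicate s a ++ replicate (ℓ ∸ s) b
    length≡ : length ps ≡ ℓ
    length≡ = trans (length-++ (replicate s a))
                    (trans (cong₂ _+_ (length-replicate s) (length-replicate (ℓ ∸ s))) (m+[n∸m]≡n s≤ℓ))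
    sumSuc-ps : sumSuc ps ≡ s * suc a + (ℓ ∸ s) * suc b
    sumSuc-ps = trans (sumSuc-++ (replicate s a) _) (cong₂ _+_ (sumSuc-replicate s a) (sumSuc-replicate (ℓ ∸ s) b))
    sum≡ : a + sumSuc ps ≡ d
    sum≡ = cong Data.Nat.pred (begin
      suc (a + sumSuc ps)                          ≡⟨ cong (λ x → suc (a + x)) sumSuc-ps ⟩
      suc (a + (s * suc a + (ℓ ∸ s) * suc b))      ≡⟨ cong suc (sym (+-assoc a _ _)) ⟩
      suc s * suc a + (ℓ ∸ s) * suc b              ≡⟨ parts-sum ⟩
      suc d                                        ∎)
    product≡ : suc a * productSuc ps ≡ suc a ^ suc s * suc b ^ (ℓ ∸ s)
    product≡ = begin
      suc a * productSuc ps
        ≡⟨ cong (suc a *_) (trans (productSuc-++ (replicate s a) _)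
                                  (cong₂ _*_ (productSuc-replicate s a) (productSuc-replicate (ℓ ∸ s) b))) ⟩
      suc a * (suc a ^ s * suc b ^ (ℓ ∸ s))
        ≡⟨ sym (*-assoc (suc a) (suc a ^ s) (suc b ^ (ℓ ∸ s))) ⟩
      suc a ^ suc s * suc b ^ (ℓ ∸ s) ∎

  [m+kn]/n≡k : ∀ {m} k n .{{_ : NonZero n}} → m < n → (m + k * n) / n ≡ k
  [m+kn]/n≡k {m} k n m<n = begin
    (m + k * n) / n   ≡⟨ +-distrib-/ m (k * n) remainders<n ⟩
    m / n + k * n / n ≡⟨ cong₂ _+_ (m<n⇒m/n≡0 m<n) (m*n/n≡m k n) ⟩
    k                 ∎
    where
    open ≡-Reasoning
    remainders<n : m % n + k * n % n < n
    remainders<n = subst₂ _<_ (sym (trans (cong₂ _+_ (m<n⇒m%n≡m m<n) (m*n%n≡0 k n)) (+-identityʳ m))) refl m<n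

  module _ {r k : ℕ} .{{_ : NonZero k}} (0<r : 0 < r) (r≤k : r ≤ k) where

    %≡0⇒≡ : r % k ≡ 0 → r ≡ k
    %≡0⇒≡ r%k≡0 with r <? k
    ... | yes r<k = ⊥-elim (<-irrefl (sym (trans (sym (m<n⇒m%n≡m r<k)) r%k≡0)) 0<r)
    ... | no  r≮k = ≤-antisym r≤k (≮⇒≥ r≮k)

    %≡suc⇒≡ : ∀ {ρ} → r % k ≡ suc ρ → r ≡ suc ρ
    %≡suc⇒≡ r%k≡ρ with r <? k
    ... | yes r<k = trans (sym (m<n⇒m%n≡m r<k)) r%k≡ρ
    ... | no  r≮k with trans (sym (cong (_% k) (≤-antisym r≤k (≮⇒≥ r≮k)))) r%k≡ρ
    ...   | k%k≡ρ with trans (sym (n%n≡0 k)) k%k≡ρ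
    ...     | ()

  ceil-floor-sum : ∀ d ℓ r → 0 < r → r ≤ suc ℓ → r % suc ℓ ≡ suc d % suc ℓ →
                   r * ⌈ suc d / suc ℓ ⌉ + (suc ℓ ∸ r) * ⌊ suc d / suc ℓ ⌋ ≡ suc d
  ceil-floor-sum d ℓ r 0<r r≤k r≡ with suc d % suc ℓ | m≡m%n+[m/n]*n (suc d) (suc ℓ)
  ... | zero | D≡ rewrite %≡0⇒≡ 0<r r≤k r≡ | n∸n≡0 (suc ℓ) = begin
    k * ⌈D/k⌉ + 0                ≡⟨ +-identityʳ _ ⟩
    k * ⌈D/k⌉                    ≡⟨ cong (k *_) ⌈D/k⌉≡q ⟩
    k * q                        ≡⟨ *-comm k q ⟩
    q * k                        ≡⟨ sym D≡ ⟩
    suc d                        ∎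
    where
    open ≡-Reasoning
    k = suc ℓ
    q = suc d / k
    ⌈D/k⌉ = ⌈ suc d / k ⌉
    ⌈D/k⌉≡q : ⌈D/k⌉ ≡ q
    ⌈D/k⌉≡q = trans (cong (λ x → (x + ℓ) / k) D≡)
                    (trans (cong (_/ k) (solve 2 (λ x ℓ → x :+ ℓ := ℓ :+ x) refl (q * k) ℓ))
                           ([m+kn]/n≡k q k (s≤s ≤-refl)))
  ... | suc ρ | D≡ rewrite %≡suc⇒≡ 0<r r≤k r≡ = begin
    suc ρ * ⌈D/k⌉ + (k ∸ suc ρ) * q     ≡⟨ cong (λ c → suc ρ * c + (k ∸ suc ρ) * q) ⌈D/k⌉≡1+q ⟩
    suc ρ * suc q + (k ∸ suc ρ) * q
      ≡⟨ solve 3 (λ ρ e q → ρ :* (con 1 :+ q) :+ e :* q := ρ :+ (ρ :+ e) :* q) refl (suc ρ) (k ∸ suc ρ) q ⟩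
    suc ρ + (suc ρ + (k ∸ suc ρ)) * q   ≡⟨ cong (λ x → suc ρ + x * q) (m+[n∸m]≡n ρ<k) ⟩
    suc ρ + k * q                       ≡⟨ cong (suc ρ +_) (*-comm k q) ⟩
    suc ρ + q * k                       ≡⟨ sym D≡ ⟩
    suc d                               ∎
    where
    open ≡-Reasoning
    k = suc ℓ
    q = suc d / k
    ⌈D/k⌉ = ⌈ suc d / k ⌉
    ρ<k : suc ρ ≤ k
    ρ<k = subst (_≤ k) (%≡suc⇒≡ 0<r r≤k r≡) r≤k
    ⌈D/k⌉≡1+q : ⌈D/k⌉ ≡ suc q
    ⌈D/k⌉≡1+q = trans (cong (λ x → (x + ℓ) / k) D≡)
      (trans (cong (_/ k) (solve 3 (λ ρ q ℓ → con 1 :+ ρ :+ q :* (con 1 :+ ℓ) :+ ℓ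
                                              := ρ :+ (con 1 :+ q) :* (con 1 :+ ℓ)) refl ρ q ℓ))
             ([m+kn]/n≡k (suc q) k ρ<k))

  ⌊/⌋≤⌈/⌉ : ∀ a b .{{_ : NonZero b}} → ⌊ a / b ⌋ ≤ ⌈ a / b ⌉
  ⌊/⌋≤⌈/⌉ a b = /-monoˡ-≤ b (m≤m+n a (b ∸ 1))

  -- The with-patterns omit ⌈⌉ = 0 and ⌊⌋ = 0, which the two inequalities refute.
  p≥-ceil-floor : ∀ d ℓ r → ℓ < d → 0 < r → r ≤ suc ℓ → r % suc ℓ ≡ suc d % suc ℓ →
                  p≥ d ℓ (⌈ suc d / suc ℓ ⌉ ^ r * ⌊ suc d / suc ℓ ⌋ ^ (suc ℓ ∸ r))
  p≥-ceil-floor d ℓ (suc s) ℓ<d 0<r (s≤s s≤ℓ) r≡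
    with ⌈ suc d / suc ℓ ⌉ | ⌊ suc d / suc ℓ ⌋ | ⌊/⌋≤⌈/⌉ (suc d) (suc ℓ)
       | m≥n⇒m/n>0 {suc d} {suc ℓ} (s≤s (<⇒≤ ℓ<d)) | ceil-floor-sum d ℓ (suc s) 0<r (s≤s s≤ℓ) r≡
  ... | suc a | suc b | _ | _ | parts-sum = p≥-two-sizes d ℓ s a b s≤ℓ parts-sum

module Fractions where

  open import Defs using (fromℕ; inv!; _^ℚ_)
  open import Data.Nat as ℕ using (ℕ; zero; suc; _!)
  import Data.Nat.Properties as ℕ
  open import Data.Integer as ℤ using (+_)
  import Data.Integer.Properties as ℤ
  open import Data.Rational using (ℚ; _/_; toℚᵘ; 0ℚ; 1ℚ; _+_; _*_; _≤_; nonNegative)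
  open import Data.Rational.Properties as ℚ
    using ( toℚᵘ-fromℚᵘ; toℚᵘ-injective; toℚᵘ-cancel-≤; toℚᵘ-homo-*; toℚᵘ-homo-+
          ; normalize-nonNeg; nonNegative⁻¹)
  open import Data.Rational.Unnormalised as ℚᵘ using (mkℚᵘ; *≡*; *≤*)
  import Data.Rational.Unnormalised.Properties as ℚᵘ
  open import Data.Rational.Solver using (module +-*-Solver)
  open import Relation.Binary.PropositionalEquality
    using (_≡_; refl; sym; trans; cong; cong₂; subst; subst₂; module ≡-Reasoning)

  open +-*-Solver

  -- frac a b = a / (1 + b): a denominator that is nonzero by construction.
  frac : ℕ → ℕ → ℚ
  frac a b = + a / suc b

  toℚᵘ-frac : ∀ a b → toℚᵘ (frac a b) ℚᵘ.≃ mkℚᵘ (+ a) b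
  toℚᵘ-frac a b = toℚᵘ-fromℚᵘ (mkℚᵘ (+ a) b)

  frac-≡ : ∀ a b c d → a ℕ.* suc d ≡ c ℕ.* suc b → frac a b ≡ frac c d
  frac-≡ a b c d eq = toℚᵘ-injective
    (ℚᵘ.≃-trans (toℚᵘ-frac a b) (ℚᵘ.≃-trans (*≡* cross) (ℚᵘ.≃-sym (toℚᵘ-frac c d))))
    where
    cross : + a ℤ.* + suc d ≡ + c ℤ.* + suc b
    cross = trans (sym (ℤ.pos-* a (suc d))) (trans (cong +_ eq) (ℤ.pos-* c (suc b)))

  frac-mono-≤ : ∀ a b c d → a ℕ.* suc d ℕ.≤ c ℕ.* suc b → frac a b ≤ frac c d
  frac-mono-≤ a b c d le = toℚᵘ-cancel-≤
    (ℚᵘ.≤-respˡ-≃ (ℚᵘ.≃-sym (toℚᵘ-frac a b)) (ℚᵘ.≤-respʳ-≃ (ℚᵘ.≃-sym (toℚᵘ-frac c d)) (*≤* cross)))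
    where
    cross : + a ℤ.* + suc d ℤ.≤ + c ℤ.* + suc b
    cross = subst₂ ℤ._≤_ (ℤ.pos-* a (suc d)) (ℤ.pos-* c (suc b)) (ℤ.+≤+ le)

  frac-* : ∀ a b c d → frac a b * frac c d ≡ frac (a ℕ.* c) (d ℕ.+ b ℕ.* suc d)
  frac-* a b c d = toℚᵘ-injective (ℚᵘ.≃-trans (toℚᵘ-homo-* (frac a b) (frac c d))
    (ℚᵘ.≃-trans (ℚᵘ.*-cong (toℚᵘ-frac a b) (toℚᵘ-frac c d))
    (ℚᵘ.≃-trans (ℚᵘ.≃-reflexive (cong (λ z → mkℚᵘ z (d ℕ.+ b ℕ.* suc d)) (sym (ℤ.pos-* a c))))
                (ℚᵘ.≃-sym (toℚᵘ-frac (a ℕ.* c) (d ℕ.+ b ℕ.* suc d))))))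

  frac-+ : ∀ a b c d → frac a b + frac c d ≡ frac (a ℕ.* suc d ℕ.+ c ℕ.* suc b) (d ℕ.+ b ℕ.* suc d)
  frac-+ a b c d = toℚᵘ-injective (ℚᵘ.≃-trans (toℚᵘ-homo-+ (frac a b) (frac c d))
    (ℚᵘ.≃-trans (ℚᵘ.+-cong (toℚᵘ-frac a b) (toℚᵘ-frac c d))
    (ℚᵘ.≃-trans (ℚᵘ.≃-reflexive (cong (λ z → mkℚᵘ z (d ℕ.+ b ℕ.* suc d)) numerator))
                (ℚᵘ.≃-sym (toℚᵘ-frac _ _)))))
    where
    numerator : + a ℤ.* + suc d ℤ.+ + c ℤ.* + suc b ≡ + (a ℕ.* suc d ℕ.+ c ℕ.* suc b)
    numerator = trans (cong₂ ℤ._+_ (sym (ℤ.pos-* a (suc d))) (sym (ℤ.pos-* c (suc b))))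
                      (sym (ℤ.pos-+ (a ℕ.* suc d) (c ℕ.* suc b)))

  inv!≡frac : ∀ j → inv! j ≡ frac 1 (ℕ.pred (j !))
  inv!≡frac j = lemma (j !) {{j ℕ.!≢0}} (sym (ℕ.suc-pred (j !) {{j ℕ.!≢0}}))
    where
    lemma : ∀ n .{{_ : ℕ.NonZero n}} {b} → n ≡ suc b → + 1 / n ≡ frac 1 b
    lemma .(suc _) refl = refl

  fromℕ-+ : ∀ a b → fromℕ (a ℕ.+ b) ≡ fromℕ a + fromℕ b
  fromℕ-+ a b = sym (trans (frac-+ a 0 b 0)
    (frac-≡ (a ℕ.* 1 ℕ.+ b ℕ.* 1) 0 (a ℕ.+ b) 0
            (cong (ℕ._* 1) (cong₂ ℕ._+_ (ℕ.*-identityʳ a) (ℕ.*-identityʳ b)))))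

  fromℕ-* : ∀ a b → fromℕ (a ℕ.* b) ≡ fromℕ a * fromℕ b
  fromℕ-* a b = sym (frac-* a 0 b 0)

  fromℕ-mono-≤ : ∀ {a b} → a ℕ.≤ b → fromℕ a ≤ fromℕ b
  fromℕ-mono-≤ {a} {b} a≤b = frac-mono-≤ a 0 b 0 (ℕ.*-monoˡ-≤ 1 a≤b)

  fromℕ-^ : ∀ a n → fromℕ (a ℕ.^ n) ≡ fromℕ a ^ℚ n
  fromℕ-^ a zero    = refl
  fromℕ-^ a (suc n) = trans (fromℕ-* a (a ℕ.^ n)) (cong (fromℕ a *_) (fromℕ-^ a n))

  0≤frac : ∀ a b → 0ℚ ≤ frac a b
  0≤frac a b = nonNegative⁻¹ (frac a b) {{normalize-nonNeg a (suc b)}}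

  0≤fromℕ : ∀ a → 0ℚ ≤ fromℕ a
  0≤fromℕ a = 0≤frac a 0

  0≤inv! : ∀ j → 0ℚ ≤ inv! j
  0≤inv! j = subst (0ℚ ≤_) (sym (inv!≡frac j)) (0≤frac 1 (ℕ.pred (j !)))

  p≤p+q : ∀ p {q} → 0ℚ ≤ q → p ≤ p + q
  p≤p+q p 0≤q = subst (_≤ p + _) (ℚ.+-identityʳ p) (ℚ.+-monoʳ-≤ p 0≤q)

  0≤* : ∀ {a b} → 0ℚ ≤ a → 0ℚ ≤ b → 0ℚ ≤ a * b
  0≤* {a} {b} 0≤a 0≤b = nonNegative⁻¹ (a * b)
    {{ℚ.nonNeg*nonNeg⇒nonNeg a {{nonNegative 0≤a}} b {{nonNegative 0≤b}}}}

  0≤+ : ∀ {a b} → 0ℚ ≤ a → 0ℚ ≤ b → 0ℚ ≤ a + b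
  0≤+ {a} 0≤a 0≤b = ℚ.≤-trans 0≤a (p≤p+q a 0≤b)

  *-mono-≤-nonNeg : ∀ {a b c d} → 0ℚ ≤ a → 0ℚ ≤ c → a ≤ b → c ≤ d → a * c ≤ b * d
  *-mono-≤-nonNeg {a} {b} {c} 0≤a 0≤c a≤b c≤d =
    ℚ.≤-trans (ℚ.*-monoʳ-≤-nonNeg c {{nonNegative 0≤c}} a≤b)
              (ℚ.*-monoˡ-≤-nonNeg b {{nonNegative (ℚ.≤-trans 0≤a a≤b)}} c≤d)

  0≤^ : ∀ {x} n → 0ℚ ≤ x → 0ℚ ≤ x ^ℚ n
  0≤^ zero    _   = 0≤fromℕ 1
  0≤^ (suc n) 0≤x = 0≤* 0≤x (0≤^ n 0≤x)

  ^-distribʳ-* : ∀ a b n → (a * b) ^ℚ n ≡ a ^ℚ n * b ^ℚ n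
  ^-distribʳ-* a b zero    = refl
  ^-distribʳ-* a b (suc n) = trans (cong ((a * b) *_) (^-distribʳ-* a b n))
    (solve 4 (λ a b x y → (a :* b) :* (x :* y) := (a :* x) :* (b :* y)) refl a b (a ^ℚ n) (b ^ℚ n))

  1^n≡1 : ∀ n → 1ℚ ^ℚ n ≡ 1ℚ
  1^n≡1 zero    = refl
  1^n≡1 (suc n) = cong (1ℚ *_) (1^n≡1 n)

module TruncatedExponential where

  open Fractions
  open import Defs using (fromℕ; inv!; _^ℚ_; eApprox)
  open import Data.Nat as ℕ using (ℕ; zero; suc; _!)
  import Data.Nat.Properties as ℕ
  open import Data.Rational using (ℚ; 0ℚ; 1ℚ; _+_; _*_; _≤_; nonNegative)
  import Data.Rational.Properties as ℚ
  open import Data.Rational.Solver using (module +-*-Solver)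
  open import Data.Product using (_,_)
  open import Relation.Binary.PropositionalEquality
    using (_≡_; refl; sym; trans; cong; cong₂; module ≡-Reasoning)

  open +-*-Solver

  fromℕ-suc*inv! : ∀ n → fromℕ (suc n) * inv! (suc n) ≡ inv! n
  fromℕ-suc*inv! n = begin
    fromℕ (suc n) * inv! (suc n)          ≡⟨ cong (fromℕ (suc n) *_) (inv!≡frac (suc n)) ⟩
    frac (suc n) 0 * frac 1 a             ≡⟨ frac-* (suc n) 0 1 a ⟩
    frac (suc n ℕ.* 1) (a ℕ.+ 0)          ≡⟨ frac-≡ (suc n ℕ.* 1) (a ℕ.+ 0) 1 b cross ⟩
    frac 1 b                              ≡⟨ sym (inv!≡frac n) ⟩
    inv! n                                ∎
    where
    open ≡-Reasoning
    a = ℕ.pred (suc n !)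
    b = ℕ.pred (n !)
    cross : suc n ℕ.* 1 ℕ.* suc b ≡ 1 ℕ.* suc (a ℕ.+ 0)
    cross = begin
      suc n ℕ.* 1 ℕ.* suc b   ≡⟨ cong₂ ℕ._*_ (ℕ.*-identityʳ (suc n)) (ℕ.suc-pred (n !) {{n ℕ.!≢0}}) ⟩
      suc n ℕ.* n !           ≡⟨ sym (ℕ.suc-pred (suc n !) {{suc n ℕ.!≢0}}) ⟩
      suc a                   ≡⟨ cong suc (sym (ℕ.+-identityʳ a)) ⟩
      suc (a ℕ.+ 0)           ≡⟨ sym (ℕ.*-identityˡ _) ⟩
      1 ℕ.* suc (a ℕ.+ 0)     ∎

  bernoulli : ∀ {x h} → 0ℚ ≤ x → 0ℚ ≤ h → ∀ i →
              x ^ℚ suc i + fromℕ (suc i) * h * x ^ℚ i ≤ (x + h) ^ℚ suc i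
  bernoulli {x} {h} 0≤x 0≤h zero = ℚ.≤-reflexive
    (solve 2 (λ x h → x :* con 1ℚ :+ con 1ℚ :* h :* con 1ℚ := (x :+ h) :* con 1ℚ) refl x h)
  bernoulli {x} {h} 0≤x 0≤h (suc i) = begin
    x * (x * A) + fromℕ (suc (suc i)) * h * (x * A)
      ≡⟨ cong (λ z → x * (x * A) + z * h * (x * A)) (fromℕ-+ 1 (suc i)) ⟩
    x * (x * A) + (1ℚ + c) * h * (x * A)
      ≤⟨ p≤p+q _ (0≤* (0≤* (0≤* (0≤fromℕ (suc i)) 0≤h) 0≤h) (0≤^ i 0≤x)) ⟩
    x * (x * A) + (1ℚ + c) * h * (x * A) + c * h * h * A
      ≡⟨ solve 4 (λ x h A c → x :* (x :* A) :+ (con 1ℚ :+ c) :* h :* (x :* A) :+ c :* h :* h :* A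
                              := (x :+ h) :* (x :* A :+ c :* h :* A)) refl x h A c ⟩
    (x + h) * (x * A + c * h * A)
      ≤⟨ ℚ.*-monoˡ-≤-nonNeg (x + h) {{nonNegative (0≤+ 0≤x 0≤h)}} (bernoulli 0≤x 0≤h i) ⟩
    (x + h) * (x + h) ^ℚ suc i ∎
    where
    open ℚ.≤-Reasoning
    A = x ^ℚ i
    c = fromℕ (suc i)

  expTrunc : ℕ → ℚ → ℚ
  expTrunc zero    x = 1ℚ
  expTrunc (suc n) x = expTrunc n x + x ^ℚ suc n * inv! (suc n)

  expTrunc-1 : ∀ n → expTrunc n 1ℚ ≡ eApprox n
  expTrunc-1 zero    = refl
  expTrunc-1 (suc n) = trans
    (cong₂ _+_ (expTrunc-1 n) (trans (cong (_* inv! (suc n)) (1^n≡1 (suc n))) (ℚ.*-identityˡ _)))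
    (ℚ.+-comm (eApprox n) (inv! (suc n)))

  expTrunc-≤-suc : ∀ {x} n → 0ℚ ≤ x → expTrunc n x ≤ expTrunc (suc n) x
  expTrunc-≤-suc n 0≤x = p≤p+q _ (0≤* (0≤^ (suc n) 0≤x) (0≤inv! (suc n)))

  -- The truncated form of e^x · e^h ≤ e^(x+h), keeping just enough terms for
  -- the induction: termwise it is Bernoulli's inequality.
  expTrunc-+ : ∀ {x h} → 0ℚ ≤ x → 0ℚ ≤ h → ∀ n →
               expTrunc (suc n) x + h * expTrunc n x ≤ expTrunc (suc n) (x + h)
  expTrunc-+ {x} {h} 0≤x 0≤h zero = ℚ.≤-reflexive
    (solve 2 (λ x h → con 1ℚ :+ (x :* con 1ℚ) :* con 1ℚ :+ h :* con 1ℚ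
                      := con 1ℚ :+ ((x :+ h) :* con 1ℚ) :* con 1ℚ) refl x h)
  expTrunc-+ {x} {h} 0≤x 0≤h (suc n) = begin
    (E₁ + X₂ * I₂) + h * (E₀ + X₁ * I₁)
      ≡⟨ cong (λ z → (E₁ + X₂ * I₂) + h * (E₀ + X₁ * z)) (sym (fromℕ-suc*inv! (suc n))) ⟩
    (E₁ + X₂ * I₂) + h * (E₀ + X₁ * (c * I₂))
      ≡⟨ solve 7 (λ E₁ E₀ X₂ X₁ c I₂ h → (E₁ :+ X₂ :* I₂) :+ h :* (E₀ :+ X₁ :* (c :* I₂))
                                         := (E₁ :+ h :* E₀) :+ (X₂ :+ c :* h :* X₁) :* I₂) refl E₁ E₀ X₂ X₁ c I₂ h ⟩
    (E₁ + h * E₀) + (X₂ + c * h * X₁) * I₂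
      ≤⟨ ℚ.+-mono-≤ (expTrunc-+ 0≤x 0≤h n)
                    (ℚ.*-monoʳ-≤-nonNeg I₂ {{nonNegative (0≤inv! (suc (suc n)))}} (bernoulli 0≤x 0≤h (suc n))) ⟩
    expTrunc (suc n) (x + h) + (x + h) ^ℚ suc (suc n) * I₂ ∎
    where
    open ℚ.≤-Reasoning
    E₁ = expTrunc (suc n) x
    E₀ = expTrunc n x
    X₂ = x ^ℚ suc (suc n)
    X₁ = x ^ℚ suc n
    I₂ = inv! (suc (suc n))
    I₁ = inv! (suc n)
    c  = fromℕ (suc (suc n))

  1+h^n≤expTrunc : ∀ {h} → 0ℚ ≤ h → ∀ n → (1ℚ + h) ^ℚ n ≤ expTrunc n (fromℕ n * h)
  1+h^n≤expTrunc 0≤h zero = ℚ.≤-refl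
  1+h^n≤expTrunc {h} 0≤h (suc n) = begin
    (1ℚ + h) * (1ℚ + h) ^ℚ n
      ≤⟨ ℚ.*-monoˡ-≤-nonNeg (1ℚ + h) {{nonNegative (0≤+ (0≤fromℕ 1) 0≤h)}} (1+h^n≤expTrunc 0≤h n) ⟩
    (1ℚ + h) * expTrunc n y
      ≡⟨ solve 2 (λ h E → (con 1ℚ :+ h) :* E := E :+ h :* E) refl h (expTrunc n y) ⟩
    expTrunc n y + h * expTrunc n y
      ≤⟨ ℚ.+-monoˡ-≤ (h * expTrunc n y) (expTrunc-≤-suc n 0≤y) ⟩
    expTrunc (suc n) y + h * expTrunc n y
      ≤⟨ expTrunc-+ 0≤y 0≤h n ⟩
    expTrunc (suc n) (y + h)
      ≡⟨ cong (expTrunc (suc n)) (sym (trans (cong (_* h) (fromℕ-+ 1 n))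
                                            (solve 2 (λ h y → (con 1ℚ :+ y) :* h := y :* h :+ h) refl h (fromℕ n)))) ⟩
    expTrunc (suc n) (fromℕ (suc n) * h) ∎
    where
    open ℚ.≤-Reasoning
    y = fromℕ n * h
    0≤y = 0≤* (0≤fromℕ n) 0≤h

  eApprox-mono : ∀ {j N} → j ℕ.≤ N → eApprox j ≤ eApprox N
  eApprox-mono {j} j≤N with ℕ.m≤n⇒∃[o]m+o≡n j≤N
  ... | o , refl = go o
    where
    go : ∀ o → eApprox j ≤ eApprox (j ℕ.+ o)
    go zero    = ℚ.≤-reflexive (cong eApprox (sym (ℕ.+-identityʳ j)))
    go (suc o) = ℚ.≤-trans (go o) (ℚ.≤-trans (p≤p+q _ (0≤inv! (suc (j ℕ.+ o))))
      (ℚ.≤-reflexive (trans (ℚ.+-comm (eApprox (j ℕ.+ o)) _) (cong eApprox (sym (ℕ.+-suc j o))))))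

  1≤eApprox : ∀ N → 1ℚ ≤ eApprox N
  1≤eApprox N = eApprox-mono {0} {N} ℕ.z≤n

  fromℕ-suc*frac : ∀ i → fromℕ (suc i) * frac 1 i ≡ 1ℚ
  fromℕ-suc*frac i = trans (frac-* (suc i) 0 1 i) (frac-≡ (suc i ℕ.* 1) (i ℕ.+ 0) 1 0
    (trans (ℕ.*-identityʳ (suc i ℕ.* 1)) (trans (ℕ.*-identityʳ (suc i))
      (trans (cong suc (sym (ℕ.+-identityʳ i))) (sym (ℕ.*-identityˡ (suc (i ℕ.+ 0))))))))

  [1+1/n]^n≤eApprox : ∀ i → (1ℚ + frac 1 i) ^ℚ suc i ≤ eApprox (suc i)
  [1+1/n]^n≤eApprox i = ℚ.≤-trans (1+h^n≤expTrunc (0≤frac 1 i) (suc i))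
    (ℚ.≤-reflexive (trans (cong (expTrunc (suc i)) (fromℕ-suc*frac i)) (expTrunc-1 (suc i))))

module BinomialBound where

  open Fractions
  open TruncatedExponential
  open import Defs using (fromℕ; _^ℚ_; eApprox; LeExpTimes)
  open import Data.Nat as ℕ using (ℕ; zero; suc; _!; _+_; _*_; _^_; _≤_)
  import Data.Nat.Properties as ℕ
  open import Data.Nat.Solver using () renaming (module +-*-Solver to ℕ-Solver)
  open import Data.Nat.Combinatorics using (_C_; nCk+nC[k+1]≡[n+1]C[k+1])
  open import Data.Integer using (+_)
  open import Data.Rational as ℚ using (ℚ; _/_; 0ℚ; 1ℚ; nonNegative)
  import Data.Rational.Properties as ℚ
  open import Data.Rational.Solver using (module +-*-Solver)
  open import Data.Product using (_,_)
  open import Relation.Binary.PropositionalEquality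
    using (_≡_; refl; sym; trans; cong; module ≡-Reasoning)

  bernoulliℕ : ∀ m k → m ^ suc k + suc k * m ^ k ≤ suc m ^ suc k
  bernoulliℕ m zero = ℕ.≤-reflexive (solve 1 (λ m → m :* con 1 :+ con 1 :* con 1 := (con 1 :+ m) :* con 1) refl m)
    where open ℕ-Solver
  bernoulliℕ m (suc k) = begin
    m * (m * A) + suc (suc k) * (m * A)
      ≤⟨ ℕ.m≤m+n _ (suc k * A) ⟩
    m * (m * A) + suc (suc k) * (m * A) + suc k * A
      ≡⟨ solve 3 (λ m A k → m :* (m :* A) :+ (con 2 :+ k) :* (m :* A) :+ (con 1 :+ k) :* A
                            := (con 1 :+ m) :* (m :* A :+ (con 1 :+ k) :* A)) refl m A k ⟩
    suc m * (m * A + suc k * A)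
      ≤⟨ ℕ.*-monoʳ-≤ (suc m) (bernoulliℕ m k) ⟩
    suc m * suc m ^ suc k ∎
    where
    open ℕ.≤-Reasoning
    open ℕ-Solver
    A = m ^ k

  nCk*k!≤n^k : ∀ n k → (n C k) * k ! ≤ n ^ k
  nCk*k!≤n^k zero    zero    = ℕ.≤-refl
  nCk*k!≤n^k zero    (suc k) = ℕ.z≤n
  nCk*k!≤n^k (suc n) zero    = ℕ.≤-refl
  nCk*k!≤n^k (suc n) (suc k) = begin
    (suc n C suc k) * (suc k * k !)
      ≡⟨ cong (_* (suc k * k !)) (sym (nCk+nC[k+1]≡[n+1]C[k+1] n k)) ⟩
    ((n C k) + (n C suc k)) * (suc k * k !)
      ≡⟨ solve 4 (λ a b s f → (a :+ b) :* (s :* f) := s :* (a :* f) :+ b :* (s :* f)) refl (n C k) (n C suc k) (suc k) (k !) ⟩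
    suc k * ((n C k) * k !) + (n C suc k) * (suc k * k !)
      ≤⟨ ℕ.+-mono-≤ (ℕ.*-monoʳ-≤ (suc k) (nCk*k!≤n^k n k)) (nCk*k!≤n^k n (suc k)) ⟩
    suc k * n ^ k + n ^ suc k
      ≡⟨ ℕ.+-comm (suc k * n ^ k) _ ⟩
    n ^ suc k + suc k * n ^ k
      ≤⟨ bernoulliℕ n k ⟩
    suc n ^ suc k ∎
    where
    open ℕ.≤-Reasoning
    open ℕ-Solver

  open +-*-Solver

  module _ (N : ℕ) where

    private
      e = eApprox N
      0≤e : 0ℚ ℚ.≤ e
      0≤e = ℚ.≤-trans (0≤fromℕ 1) (1≤eApprox N)

    [1+j]^j≤j^j*e : ∀ j → j ≤ N → fromℕ (suc j ^ j) ℚ.≤ fromℕ (j ^ j) ℚ.* e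
    [1+j]^j≤j^j*e zero    _   = ℚ.≤-trans (1≤eApprox N) (ℚ.≤-reflexive (sym (ℚ.*-identityˡ e)))
    [1+j]^j≤j^j*e (suc i) i<N = begin
      fromℕ (suc (suc i) ^ suc i)                     ≡⟨ fromℕ-^ (suc (suc i)) (suc i) ⟩
      fromℕ (suc (suc i)) ^ℚ suc i                    ≡⟨ cong (_^ℚ suc i) 2+i≡[1+i]*[1+1/[1+i]] ⟩
      (fromℕ (suc i) ℚ.* (1ℚ ℚ.+ frac 1 i)) ^ℚ suc i  ≡⟨ ^-distribʳ-* (fromℕ (suc i)) (1ℚ ℚ.+ frac 1 i) (suc i) ⟩
      fromℕ (suc i) ^ℚ suc i ℚ.* (1ℚ ℚ.+ frac 1 i) ^ℚ suc i
        ≤⟨ *-mono-≤-nonNeg (0≤^ (suc i) (0≤fromℕ (suc i))) (0≤^ (suc i) (0≤+ (0≤fromℕ 1) (0≤frac 1 i))) ℚ.≤-refl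
             (ℚ.≤-trans ([1+1/n]^n≤eApprox i) (eApprox-mono i<N)) ⟩
      fromℕ (suc i) ^ℚ suc i ℚ.* e                    ≡⟨ cong (ℚ._* e) (sym (fromℕ-^ (suc i) (suc i))) ⟩
      fromℕ (suc i ^ suc i) ℚ.* e                     ∎
      where
      open ℚ.≤-Reasoning
      2+i≡[1+i]*[1+1/[1+i]] : fromℕ (suc (suc i)) ≡ fromℕ (suc i) ℚ.* (1ℚ ℚ.+ frac 1 i)
      2+i≡[1+i]*[1+1/[1+i]] = begin-equality
        fromℕ (1 + suc i)                                 ≡⟨ fromℕ-+ 1 (suc i) ⟩
        1ℚ ℚ.+ fromℕ (suc i)                              ≡⟨ cong (ℚ._+ fromℕ (suc i)) (sym (fromℕ-suc*frac i)) ⟩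
        fromℕ (suc i) ℚ.* frac 1 i ℚ.+ fromℕ (suc i)
          ≡⟨ solve 2 (λ a b → a :* b :+ a := a :* (con 1ℚ :+ b)) refl (fromℕ (suc i)) (frac 1 i) ⟩
        fromℕ (suc i) ℚ.* (1ℚ ℚ.+ frac 1 i)               ∎

    k^k≤k!*e^k : ∀ k → k ≤ N → fromℕ (k ^ k) ℚ.≤ fromℕ (k !) ℚ.* e ^ℚ k
    k^k≤k!*e^k zero    _   = ℚ.≤-refl
    k^k≤k!*e^k (suc j) j<N = begin
      fromℕ (suc j * suc j ^ j)                   ≡⟨ fromℕ-* (suc j) (suc j ^ j) ⟩
      fromℕ (suc j) ℚ.* fromℕ (suc j ^ j)
        ≤⟨ ℚ.*-monoˡ-≤-nonNeg (fromℕ (suc j)) {{nonNegative (0≤fromℕ (suc j))}} ([1+j]^j≤j^j*e j j≤N) ⟩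
      fromℕ (suc j) ℚ.* (fromℕ (j ^ j) ℚ.* e)
        ≤⟨ ℚ.*-monoˡ-≤-nonNeg (fromℕ (suc j)) {{nonNegative (0≤fromℕ (suc j))}}
             (ℚ.*-monoʳ-≤-nonNeg e {{nonNegative 0≤e}} (k^k≤k!*e^k j j≤N)) ⟩
      fromℕ (suc j) ℚ.* ((fromℕ (j !) ℚ.* e ^ℚ j) ℚ.* e)
        ≡⟨ solve 4 (λ a b c d → a :* ((b :* c) :* d) := (a :* b) :* (d :* c))
                   refl (fromℕ (suc j)) (fromℕ (j !)) (e ^ℚ j) e ⟩
      (fromℕ (suc j) ℚ.* fromℕ (j !)) ℚ.* (e ℚ.* e ^ℚ j) ≡⟨ cong (ℚ._* (e ℚ.* e ^ℚ j)) (sym (fromℕ-* (suc j) (j !))) ⟩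
      fromℕ (suc j * j !) ℚ.* (e ℚ.* e ^ℚ j)     ∎
      where
      open ℚ.≤-Reasoning
      j≤N = ℕ.≤-trans (ℕ.n≤1+n j) j<N

  -- e may be replaced by its k-th partial sum: it already bounds k^k / k!.
  LeExpTimes-binomial : ∀ m ℓ → LeExpTimes (suc ℓ) (fromℕ (m C suc ℓ)) ((+ m / suc ℓ) ^ℚ suc ℓ)
  LeExpTimes-binomial m ℓ ε ε>0 = k , ℚ.≤-trans binomial≤ (p≤p+q _ (ℚ.<⇒≤ ε>0))
    where
    k = suc ℓ
    E = eApprox k ^ℚ k
    X = frac m ℓ ^ℚ k
    k!ℚ = fromℕ (k !)
    m/k*k≡m : frac m ℓ ℚ.* fromℕ k ≡ fromℕ m
    m/k*k≡m = trans (frac-* m ℓ k 0) (frac-≡ (m * k) (0 + ℓ * 1) m 0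
                (trans (ℕ.*-identityʳ _) (cong (m *_) (cong suc (sym (ℕ.*-identityʳ ℓ))))))
    binomial*k!≤ : fromℕ (m C k) ℚ.* k!ℚ ℚ.≤ (E ℚ.* X) ℚ.* k!ℚ
    binomial*k!≤ = begin
      fromℕ (m C k) ℚ.* k!ℚ             ≡⟨ sym (fromℕ-* (m C k) (k !)) ⟩
      fromℕ ((m C k) * k !)             ≤⟨ fromℕ-mono-≤ (nCk*k!≤n^k m k) ⟩
      fromℕ (m ^ k)                     ≡⟨ fromℕ-^ m k ⟩
      fromℕ m ^ℚ k                      ≡⟨ cong (_^ℚ k) (sym m/k*k≡m) ⟩
      (frac m ℓ ℚ.* fromℕ k) ^ℚ k       ≡⟨ ^-distribʳ-* (frac m ℓ) (fromℕ k) k ⟩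
      X ℚ.* fromℕ k ^ℚ k                ≡⟨ cong (X ℚ.*_) (sym (fromℕ-^ k k)) ⟩
      X ℚ.* fromℕ (k ^ k)
        ≤⟨ ℚ.*-monoˡ-≤-nonNeg X {{nonNegative (0≤^ k (0≤frac m ℓ))}} (k^k≤k!*e^k k k ℕ.≤-refl) ⟩
      X ℚ.* (k!ℚ ℚ.* E)                 ≡⟨ solve 3 (λ X f E → X :* (f :* E) := (E :* X) :* f) refl X k!ℚ E ⟩
      (E ℚ.* X) ℚ.* k!ℚ                 ∎
      where open ℚ.≤-Reasoning
    binomial≤ : fromℕ (m C k) ℚ.≤ E ℚ.* X
    binomial≤ = ℚ.*-cancelʳ-≤-pos k!ℚ {{ℚ.normalize-pos (k !) 1 {{_}} {{k ℕ.!≢0}}}} binomial*k!≤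

open import Defs
open import Data.Nat using (ℕ; suc; _≤_; _<_; _*_; _^_; _∸_)
open import Data.Nat.DivMod using (_%_)
open import Data.Nat.Combinatorics using (_C_)
open import Data.Product using (_×_; _,_)
open import Relation.Binary.PropositionalEquality using (_≡_)
open import Data.Integer using (+_)
open import Data.Rational using (_/_)
open UpperBound using (p≤-binomial)
open LowerBound using (p≥-ceil-floor)
open BinomialBound using (LeExpTimes-binomial)

theorem1 : (n d ℓ r : ℕ) → 1 ≤ ℓ → ℓ < d → d < n →
    0 < r → r ≤ suc ℓ → r % suc ℓ ≡ suc d % suc ℓ →
    LeExpTimes (suc ℓ) (fromℕ (suc d C suc ℓ)) ((+ suc d / suc ℓ) ^ℚ suc ℓ)
    × p≤ d ℓ (suc d C suc ℓ)
    × p≥ d ℓ ((⌈ suc d / suc ℓ ⌉ ^ r) * (⌊ suc d / suc ℓ ⌋ ^ (suc ℓ ∸ r)))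
theorem1 n d ℓ r _ ℓ<d _ 0<r r≤ℓ+1 r≡d+1 =
  LeExpTimes-binomial (suc d) ℓ , p≤-binomial d ℓ , p≥-ceil-floor d ℓ r ℓ<d 0<r r≤ℓ+1 r≡d+1
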